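{- Let $\mathcal{K}$ be a regular incidence complex of rank $n\ge 1$, let $\Gamma$ be a flag-transitive subgroup of $\Gamma(\mathcal{K})$, let $\Phi=\{F_{ -1},F_0,\dots,F_n\}$ be a flag of $\mathcal{K}$ with $F_i$ of rank $i$, and let $N=\{ -1,0,\dots,n\}$. For $i\in N$ let $R_i$ be the subgroup of $\Gamma$ consisting of all $\varphi\in\Gamma$ with $F_j\varphi=F_j$ for all $j\ne i$. Then for every $J\subseteq N$, the stabilizer in $\Gamma$ of $\Phi_J=\{F_j: j\in J\}$ (the set of $\varphi\in\Gamma$ fixing each $F_j$, $j\in J$) equals the subgroup $\langle R_j : j\in N\setminus J\rangle$, where for $J=N$ this subgroup is interpreted as $R_{ -1}$.
   Context: A partially ordered set $\mathcal{K}$ is an incidence complex of rank $n$ if: (I1) it has a least face and a greatest face; (I2) every chain is contained in a maximal chain (flag) with exactly $n+2$ elements (giving a rank function with values $-1,\dots,n$, each flag containing one face of each rank); (I3) every section $G/F=\{H: F\le H\le G\}$ (including $\mathcal{K}$) is connected, where a poset of rank $\le1$ is connected and one of rank $\ge2$ is connected if any two proper faces are joined by a finite sequence of proper faces with consecutive members comparable; (I4) for $i=0,\dots,n-1$, whenever $F<G$ with ranks $i-1$ and $i+1$ there are at least two $i$-faces strictly between them. $\Gamma(\mathcal{K})$ is the group of order-preserving bijections $\mathcal{K}\to\mathcal{K}$ (with order-preserving inverse); $\mathcal{K}$ is regular if $\Gamma(\mathcal{K})$ is transitive on flags. A subgroup $\Gamma\le\Gamma(\mathcal{K})$ is flag-transitive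 if it acts transitively on flags. Automorphisms act on the right: $F\varphi$ is the image of $F$, and $\varphi\psi$ means first $\varphi$, then $\psi$. -}

module Defs where

open import Level using (Level; _⊔_) renaming (suc to lsuc)
open import Data.Nat using (ℕ; zero; suc; _+_) renaming (_≤_ to _≤ℕ_)
open import Data.Fin using (Fin; toℕ) renaming (_<_ to _<ᶠ_)
open import Data.Fin.Subset using (Subset; _∈_; _∉_)
open import Data.Product using (Σ; ∃; ∃₂; _×_; _,_)
open import Data.Sum using (_⊎_)
open import Relation.Nullary using (¬_)
open import Relation.Binary using (IsPartialOrder)
open import Relation.Binary.PropositionalEquality using (_≡_; _≢_)
open import Relation.Binary.Construct.Closure.ReflexiveTransitive using (Star)

-- Everything is relative to a poset (Face, _≤_).  Faces of rank i
-- (i = -1, 0, ..., n) of a flag are indexed by Fin (2 + n): index k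
-- corresponds to rank k - 1.
module _ {a ℓ : Level} {Face : Set a} (_≤_ : Face → Face → Set ℓ) where

  _<_ : Face → Face → Set (a ⊔ ℓ)
  x < y = (x ≤ y) × (x ≢ y)

  Comparable : Face → Face → Set ℓ
  Comparable x y = (x ≤ y) ⊎ (y ≤ x)

  IsChain : (Face → Set a) → Set (a ⊔ ℓ)
  IsChain C = ∀ x y → C x → C y → Comparable x y

  record Flag (n : ℕ) : Set (a ⊔ ℓ) where
    field
      face    : Fin (suc (suc n)) → Face
      strict  : ∀ i j → i <ᶠ j → face i < face j
      maximal : ∀ G → (∀ i → Comparable G (face i)) → ∃ λ i → G ≡ face i
  open Flag public

  -- "G has rank (toℕ i - 1)": G is the i-th member of some flag
  HasRank : (n : ℕ) → Face → Fin (suc (suc n)) → Set (a ⊔ ℓ)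
  HasRank n G i = Σ (Flag n) λ Ψ → face Ψ i ≡ G

  I1 : Set (a ⊔ ℓ)
  I1 = (∃ λ F → ∀ G → F ≤ G) × (∃ λ F → ∀ G → G ≤ F)

  I2 : ℕ → Set (lsuc a ⊔ ℓ)
  I2 n = ∀ (C : Face → Set a) → IsChain C →
         Σ (Flag n) λ Ψ → ∀ x → C x → ∃ λ i → x ≡ face Ψ i

  -- consecutive members of a connecting sequence in the section G/F:
  -- both proper faces of G/F and comparable
  Link : Face → Face → Face → Face → Set (a ⊔ ℓ)
  Link F G x y = ((F < x) × (x < G)) × ((F < y) × (y < G)) × Comparable x y

  -- (I3): every section G/F of rank >= 2 (i.e. rank G - rank F >= 3)
  -- is connected; sections of rank <= 1 are connected by convention.
  I3 : ℕ → Set (a ⊔ ℓ)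
  I3 n = ∀ F G (i j : Fin (suc (suc n))) → HasRank n F i → HasRank n G j →
         3 + toℕ i ≤ℕ toℕ j →
         ∀ H H' → F < H → H < G → F < H' → H' < G → Star (Link F G) H H'

  I4 : ℕ → Set (a ⊔ ℓ)
  I4 n = ∀ F G (i j k : Fin (suc (suc n))) →
         toℕ j ≡ suc (toℕ i) → toℕ k ≡ suc (toℕ j) →
         HasRank n F i → HasRank n G k → F < G →
         ∃₂ λ H H' → H ≢ H' × HasRank n H j × HasRank n H' j ×
                     (F < H) × (H < G) × (F < H') × (H' < G)

  record IsIncidenceComplex (n : ℕ) : Set (lsuc a ⊔ ℓ) where
    field
      isPartialOrder : IsPartialOrder _≡_ _≤_
      i1 : I1
      i2 : I2 n
      i3 : I3 n
      i4 : I4 n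

  record Aut : Set (a ⊔ ℓ) where
    field
      to       : Face → Face
      from     : Face → Face
      from-to  : ∀ x → from (to x) ≡ x
      to-from  : ∀ x → to (from x) ≡ x
      to-mono   : ∀ {x y} → x ≤ y → to x ≤ to y
      from-mono : ∀ {x y} → x ≤ y → from x ≤ from y
  open Aut public

  _≈_ : Aut → Aut → Set a
  φ ≈ ψ = ∀ x → to φ x ≡ to ψ x

  idA : Aut
  idA = record { to = λ x → x ; from = λ x → x ; from-to = λ _ → _≡_.refl
               ; to-from = λ _ → _≡_.refl ; to-mono = λ p → p ; from-mono = λ p → p }

  -- φ ∙ ψ : first φ, then ψ (right action)
  _∙_ : Aut → Aut → Aut
  φ ∙ ψ = record
    { to = λ x → to ψ (to φ x)
    ; from = λ x → from φ (from ψ x)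
    ; from-to = λ x → Relation.Binary.PropositionalEquality.trans
                  (Relation.Binary.PropositionalEquality.cong (from φ) (from-to ψ (to φ x)))
                  (from-to φ x)
    ; to-from = λ x → Relation.Binary.PropositionalEquality.trans
                  (Relation.Binary.PropositionalEquality.cong (to ψ) (to-from φ (from ψ x)))
                  (to-from ψ x)
    ; to-mono = λ p → to-mono ψ (to-mono φ p)
    ; from-mono = λ p → from-mono φ (from-mono ψ p)
    }

  _⁻¹ : Aut → Aut
  φ ⁻¹ = record { to = from φ ; from = to φ ; from-to = to-from φ ; to-from = from-to φ
                ; to-mono = from-mono φ ; from-mono = to-mono φ }

  record IsSubgroup {b : Level} (Γ : Aut → Set b) : Set (a ⊔ ℓ ⊔ b) where
    field
      resp  : ∀ {φ ψ} → φ ≈ ψ → Γ φ → Γ ψ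
      has-id : Γ idA
      has-∙  : ∀ {φ ψ} → Γ φ → Γ ψ → Γ (φ ∙ ψ)
      has-⁻¹ : ∀ {φ} → Γ φ → Γ (φ ⁻¹)

  data ⟨_⟩ {b : Level} (S : Aut → Set b) : Aut → Set (a ⊔ ℓ ⊔ b) where
    gen  : ∀ {φ} → S φ → ⟨ S ⟩ φ
    unit : ⟨ S ⟩ idA
    mul  : ∀ {φ ψ} → ⟨ S ⟩ φ → ⟨ S ⟩ ψ → ⟨ S ⟩ (φ ∙ ψ)
    inv  : ∀ {φ} → ⟨ S ⟩ φ → ⟨ S ⟩ (φ ⁻¹)
    resp : ∀ {φ ψ} → φ ≈ ψ → ⟨ S ⟩ φ → ⟨ S ⟩ ψ

  FlagTransitive : {b : Level} (n : ℕ) → (Aut → Set b) → Set (a ⊔ ℓ ⊔ b)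
  FlagTransitive n Γ = ∀ (Ψ Ψ' : Flag n) →
    ∃ λ φ → Γ φ × (∀ i → to φ (face Ψ i) ≡ face Ψ' i)

  Regular : ℕ → Set (a ⊔ ℓ)
  Regular n = ∀ (Ψ Ψ' : Flag n) → ∃ λ φ → ∀ i → to φ (face Ψ i) ≡ face Ψ' i

  module _ {b : Level} {n : ℕ} (Γ : Aut → Set b) (Φ : Flag n) where

    -- R_i (i given as index in Fin (n+2), index k ↔ rank k - 1)
    R : Fin (suc (suc n)) → Aut → Set (a ⊔ b)
    R i φ = Γ φ × (∀ j → j ≢ i → to φ (face Φ j) ≡ face Φ j)

    Stab : Subset (suc (suc n)) → Aut → Set (a ⊔ b)
    Stab J φ = Γ φ × (∀ j → j ∈ J → to φ (face Φ j) ≡ face Φ j)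

    Gens : Subset (suc (suc n)) → Aut → Set (a ⊔ b)
    Gens J φ = ∃ λ j → j ∉ J × R j φ

_≐_ : {c b₁ b₂ : Level} {A : Set c} → (A → Set b₁) → (A → Set b₂) → Set (c ⊔ b₁ ⊔ b₂)
P ≐ Q = (∀ x → P x → Q x) × (∀ x → Q x → P x)

module Submission where

-- The inclusion ⟨R_j : j ∉ J⟩ ⊆ Stab(Φ_J) is immediate.  The converse rests on
-- a combinatorial fact about flags (module FlagTheory): two flags with the same
-- faces at the positions in J are joined by a sequence of flags in which
-- consecutive flags differ in a single position outside J.  It is proved by
-- induction on the width of a window (p, q) outside of which the flags agree:
-- either the window is empty, or it contains a position of J (splice the flags
-- there), or a single free position (one step), or it spans a section of rank
-- ≥ 2, which is connected by (I3).  The maximality axiom (I2) provides the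
-- splicing and shows that a face occupies the same position in every flag.
-- Module FlagStabilizers turns such a sequence into group elements: by flag
-- transitivity a step across position j is realised by an element of R_j.
-- For J = N one uses that every automorphism fixes the least face.

open import Defs
open import Level using (Level; _⊔_)
open import Function using (_∘_; id)
open import Data.Nat using (ℕ; suc; _≤_)
import Data.Nat as ℕ
import Data.Nat.Properties as ℕP
open import Data.Fin using (Fin; zero; toℕ; fromℕ; fromℕ<)
  renaming (suc to fsuc; _≤_ to _≤ᶠ_; _<_ to _<ᶠ_)
import Data.Fin.Properties as FP
open import Data.Fin.Subset using (Subset; ⊤; _∈_; _∉_)
open import Data.Fin.Subset.Properties using (_∈?_; ∈⊤; ⊆⊤; ⊆-antisym)
open import Data.Product using (_×_; _,_; proj₁; proj₂; Σ; ∃)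
open import Data.Sum using (_⊎_; inj₁; inj₂; [_,_]′) renaming (swap to swap⊎)
open import Data.Empty using (⊥; ⊥-elim)
open import Relation.Nullary using (¬_; Dec; yes; no)
open import Relation.Nullary.Decidable using (_×-dec_; ¬?; decidable-stable)
open import Relation.Binary using (IsPartialOrder; tri<; tri≈; tri>)
open import Relation.Binary.PropositionalEquality
  using (_≡_; _≢_; refl; sym; trans; cong; subst; subst₂; module ≡-Reasoning)
open import Relation.Binary.Construct.Closure.ReflexiveTransitive
  using (Star; ε; _◅_; _◅◅_; fold)
import Relation.Binary.Construct.NonStrictToStrict as NonStrictToStrict

missing-position : ∀ {m} (J : Subset m) → J ≢ ⊤ → ∃ (_∉ J)
missing-position J J≢⊤ with FP.any? (λ j → ¬? (j ∈? J))
... | yes found = found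
... | no none = ⊥-elim (J≢⊤ (⊆-antisym ⊆⊤ λ {j} _ →
                  decidable-stable (j ∈? J) (λ j∉J → none (j , j∉J))))

Outside : ∀ {m} → Fin m → Fin m → Fin m → Set
Outside p q i = i ≤ᶠ p ⊎ q ≤ᶠ i

position : ∀ {m} (p q i : Fin m) → Outside p q i ⊎ (p <ᶠ i × i <ᶠ q)
position p q i with i FP.≤? p | q FP.≤? i
... | yes i≤p | _        = inj₁ (inj₁ i≤p)
... | no _    | yes q≤i  = inj₁ (inj₂ q≤i)
... | no i≰p  | no q≰i   = inj₂ (ℕP.≰⇒> i≰p , ℕP.≰⇒> q≰i)

module FlagTheory {a ℓ : Level} {Face : Set a} (_≼_ : Face → Face → Set ℓ) (n : ℕ)
                  (ic : IsIncidenceComplex _≼_ n) where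
  open IsIncidenceComplex ic
  open IsPartialOrder isPartialOrder
    using (antisym; reflexive; ≤-respˡ-≈) renaming (trans to ≼-trans)
  open NonStrictToStrict _≡_ _≼_ using (≤-<-trans)

  N : ℕ
  N = suc (suc n)

  Fl : Set (a ⊔ ℓ)
  Fl = Flag _≼_ n

  _≺_ : Face → Face → Set (a ⊔ ℓ)
  _≺_ = _<_ _≼_

  ≼-≺-trans : ∀ {x y z} → x ≼ y → y ≺ z → x ≺ z
  ≼-≺-trans = ≤-<-trans ≼-trans antisym ≤-respˡ-≈

  Agree : (Fin N → Set) → Fl → Fl → Set a
  Agree S Ψ Ψ' = ∀ i → S i → face Ψ i ≡ face Ψ' i

  OnFlag : Fl → Face → Set a
  OnFlag Ξ x = ∃ λ r → x ≡ face Ξ r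

  face-mono : (Ψ : Fl) {i j : Fin N} → i ≤ᶠ j → face Ψ i ≼ face Ψ j
  face-mono Ψ {i} {j} i≤j with ℕP.m≤n⇒m<n∨m≡n i≤j
  ... | inj₁ i<j = proj₁ (strict Ψ i j i<j)
  ... | inj₂ i≡j = reflexive (cong (face Ψ) (FP.toℕ-injective i≡j))

  faces-comparable : (Ψ : Fl) (i j : Fin N) → Comparable _≼_ (face Ψ i) (face Ψ j)
  faces-comparable Ψ i j = [ inj₁ ∘ face-mono Ψ , inj₂ ∘ face-mono Ψ ]′ (FP.≤-total i j)

  face-reflect : (Ψ : Fl) (i j : Fin N) → face Ψ i ≺ face Ψ j → i <ᶠ j
  face-reflect Ψ i j (i≼j , i≢j) with j FP.≤? i
  ... | yes j≤i = ⊥-elim (i≢j (antisym i≼j (face-mono Ψ j≤i)))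
  ... | no j≰i  = ℕP.≰⇒> j≰i

  -- By (I2) every chain lies in a flag, so no strict chain has n+3 members.
  no-long-chain : (g : Fin (suc N) → Face) → (∀ i j → i <ᶠ j → g i ≺ g j) → ⊥
  no-long-chain g g-strict with i2 (λ x → ∃ λ k → x ≡ g k) g-chain
    where
    g-chain : IsChain _≼_ (λ x → ∃ λ k → x ≡ g k)
    g-chain _ _ (k , refl) (k' , refl) with FP.<-cmp k k'
    ... | tri< k<k' _ _ = inj₁ (proj₁ (g-strict k k' k<k'))
    ... | tri≈ _ refl _ = inj₁ (reflexive refl)
    ... | tri> _ _ k'<k = inj₂ (proj₁ (g-strict k' k k'<k))
  ... | Ξ , on-Ξ with FP.pigeonhole (ℕP.n<1+n N) (λ k → proj₁ (on-Ξ (g k) (k , refl)))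
  ... | i , j , i<j , same-position =
    proj₂ (g-strict i j i<j) (trans (proj₂ (on-Ξ (g i) (i , refl)))
      (trans (cong (face Ξ) same-position) (sym (proj₂ (on-Ξ (g j) (j , refl))))))

  -- A face cannot sit lower in B than in A: the faces of A up to position i
  -- followed by those of B above position t would form a too long strict chain.
  no-position-drop : (A B : Fl) (i t : Fin N) → face A i ≡ face B t → t <ᶠ i → ⊥
  no-position-drop A B i t Ai≡Bt t<i =
    no-long-chain (λ k → g k (toℕ k ℕ.≤? toℕ i))
                  (λ k k' → g-strict k k' (toℕ k ℕ.≤? toℕ i) (toℕ k' ℕ.≤? toℕ i))
    where
    shifted< : (k : Fin (suc N)) → ¬ (toℕ k ℕ.≤ toℕ i) → (toℕ k ℕ.∸ toℕ i) ℕ.+ toℕ t ℕ.< N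
    shifted< k k≰i = ℕP.<-≤-trans
      (subst ((toℕ k ℕ.∸ toℕ i) ℕ.+ toℕ t ℕ.<_) (ℕP.m∸n+n≡m (ℕP.<⇒≤ (ℕP.≰⇒> k≰i)))
             (ℕP.+-monoʳ-< (toℕ k ℕ.∸ toℕ i) t<i))
      (ℕP.≤-pred (FP.toℕ<n k))

    g : (k : Fin (suc N)) → Dec (toℕ k ℕ.≤ toℕ i) → Face
    g k (yes k≤i) = face A (fromℕ< (ℕP.≤-<-trans k≤i (FP.toℕ<n i)))
    g k (no k≰i)  = face B (fromℕ< (shifted< k k≰i))

    g-strict : ∀ k k' (d : Dec (toℕ k ℕ.≤ toℕ i)) (d' : Dec (toℕ k' ℕ.≤ toℕ i)) →
               toℕ k ℕ.< toℕ k' → g k d ≺ g k' d'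
    g-strict k k' (yes _) (yes _) k<k' =
      strict A _ _ (subst₂ ℕ._<_ (sym (FP.toℕ-fromℕ< _)) (sym (FP.toℕ-fromℕ< _)) k<k')
    g-strict k k' (yes k≤i) (no k'≰i) _ =
      ≼-≺-trans (face-mono A (subst (ℕ._≤ toℕ i) (sym (FP.toℕ-fromℕ< _)) k≤i))
        (subst (_≺ g k' (no k'≰i)) (sym Ai≡Bt)
          (strict B t _ (subst (toℕ t ℕ.<_) (sym (FP.toℕ-fromℕ< _))
            (ℕP.m<n+m (toℕ t) (ℕP.m<n⇒0<n∸m (ℕP.≰⇒> k'≰i))))))
    g-strict k k' (no k≰i) (yes k'≤i) k<k' =
      ⊥-elim (ℕP.<-irrefl refl (ℕP.<-trans (ℕP.≤-<-trans k'≤i (ℕP.≰⇒> k≰i)) k<k'))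
    g-strict k k' (no k≰i) (no _) k<k' =
      strict B _ _ (subst₂ ℕ._<_ (sym (FP.toℕ-fromℕ< _)) (sym (FP.toℕ-fromℕ< _))
        (ℕP.+-monoˡ-< (toℕ t) (ℕP.∸-monoˡ-< k<k' (ℕP.<⇒≤ (ℕP.≰⇒> k≰i)))))

  rank-unique : (A B : Fl) (i t : Fin N) → face A i ≡ face B t → i ≡ t
  rank-unique A B i t Ai≡Bt with FP.<-cmp i t
  ... | tri< i<t _ _ = ⊥-elim (no-position-drop B A t i (sym Ai≡Bt) i<t)
  ... | tri≈ _ i≡t _ = i≡t
  ... | tri> _ _ t<i = ⊥-elim (no-position-drop A B i t Ai≡Bt t<i)

  on-flag-at : (Ξ A : Fl) (i : Fin N) → OnFlag Ξ (face A i) → face A i ≡ face Ξ i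
  on-flag-at Ξ A i (k , Ai≡Ξk) with rank-unique A Ξ i k Ai≡Ξk
  ... | refl = Ai≡Ξk

  -- The faces of Ψ at the positions in S together with further faces X form a
  -- chain (under the stated comparabilities); by (I2) it lies in a flag Ξ, which
  -- then agrees with Ψ on S.
  extend-chain : (Ψ : Fl) (S : Fin N → Set) (X : Face → Set a) →
    (∀ x y → X x → X y → Comparable _≼_ x y) →
    (∀ i x → S i → X x → Comparable _≼_ (face Ψ i) x) →
    Σ Fl λ Ξ → Agree S Ψ Ξ × (∀ x → X x → OnFlag Ξ x)
  extend-chain Ψ S X X-chain cross with i2 C C-chain
    where
    C : Face → Set a
    C z = (∃ λ i → S i × z ≡ face Ψ i) ⊎ X z
    C-chain : IsChain _≼_ C
    C-chain _ _ (inj₁ (i , _ , refl)) (inj₁ (j , _ , refl)) = faces-comparable Ψ i j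
    C-chain _ y (inj₁ (i , i∈S , refl)) (inj₂ Xy)       = cross i y i∈S Xy
    C-chain x _ (inj₂ Xx) (inj₁ (j , j∈S , refl))       = swap⊎ (cross j x j∈S Xx)
    C-chain x y (inj₂ Xx) (inj₂ Xy)                     = X-chain x y Xx Xy
  ... | Ξ , on-Ξ = Ξ , (λ i i∈S → on-flag-at Ξ Ψ i (on-Ξ (face Ψ i) (inj₁ (i , i∈S , refl))))
                     , (λ x Xx → on-Ξ x (inj₂ Xx))

  splice : (A B : Fl) (r : Fin N) → face A r ≡ face B r →
           Σ Fl λ Ξ → Agree (_≤ᶠ r) A Ξ × Agree (r ≤ᶠ_) Ξ B
  splice A B r Ar≡Br with extend-chain A (_≤ᶠ r) B-above B-chain cross
    where
    B-above : Face → Set a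
    B-above z = ∃ λ j → r ≤ᶠ j × z ≡ face B j
    B-chain : ∀ x y → B-above x → B-above y → Comparable _≼_ x y
    B-chain _ _ (i , _ , refl) (j , _ , refl) = faces-comparable B i j
    cross : ∀ i x → i ≤ᶠ r → B-above x → Comparable _≼_ (face A i) x
    cross i _ i≤r (j , r≤j , refl) =
      inj₁ (≼-trans (face-mono A i≤r) (subst (_≼ face B j) (sym Ar≡Br) (face-mono B r≤j)))
  ... | Ξ , A≈Ξ , on-Ξ =
    Ξ , A≈Ξ , λ i r≤i → sym (on-flag-at Ξ B i (on-Ξ (face B i) (i , r≤i , refl)))

  spliced-agrees : ∀ {A B Ξ : Fl} {r : Fin N} {S : Fin N → Set} →
    Agree (_≤ᶠ r) A Ξ → Agree (r ≤ᶠ_) Ξ B → Agree S A B → Agree S A Ξ × Agree S Ξ B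
  spliced-agrees {A} {B} {Ξ} {r} {S} low high A≈B =
    (λ i s → proj₁ (at i s)) , (λ i s → proj₂ (at i s))
    where
    at : ∀ i → S i → (face A i ≡ face Ξ i) × (face Ξ i ≡ face B i)
    at i s with FP.≤-total i r
    ... | inj₁ i≤r = low i i≤r , trans (sym (low i i≤r)) (A≈B i s)
    ... | inj₂ r≤i = trans (A≈B i s) (sym (high i r≤i)) , high i r≤i

  extend-in-section : (Ψ : Fl) (p q : Fin N) {x y : Face} →
    face Ψ p ≼ x → x ≼ face Ψ q → face Ψ p ≼ y → y ≼ face Ψ q → Comparable _≼_ x y →
    Σ Fl λ Ξ → Agree (Outside p q) Ψ Ξ × OnFlag Ξ x × OnFlag Ξ y
  extend-in-section Ψ p q {x} {y} px xq py yq x~y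
    with extend-chain Ψ (Outside p q) (λ z → z ≡ x ⊎ z ≡ y) pair-chain cross
    where
    pair-chain : ∀ z w → z ≡ x ⊎ z ≡ y → w ≡ x ⊎ w ≡ y → Comparable _≼_ z w
    pair-chain _ _ (inj₁ refl) (inj₁ refl) = inj₁ (reflexive refl)
    pair-chain _ _ (inj₁ refl) (inj₂ refl) = x~y
    pair-chain _ _ (inj₂ refl) (inj₁ refl) = swap⊎ x~y
    pair-chain _ _ (inj₂ refl) (inj₂ refl) = inj₁ (reflexive refl)
    inside : ∀ {z} → face Ψ p ≼ z → z ≼ face Ψ q → ∀ i → Outside p q i →
             Comparable _≼_ (face Ψ i) z
    inside pz zq i (inj₁ i≤p) = inj₁ (≼-trans (face-mono Ψ i≤p) pz)
    inside pz zq i (inj₂ q≤i) = inj₂ (≼-trans zq (face-mono Ψ q≤i))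
    cross : ∀ i z → Outside p q i → z ≡ x ⊎ z ≡ y → Comparable _≼_ (face Ψ i) z
    cross i _ o (inj₁ refl) = inside px xq i o
    cross i _ o (inj₂ refl) = inside py yq i o
  ... | Ξ , Ψ≈Ξ , on-Ξ = Ξ , Ψ≈Ξ , on-Ξ x (inj₁ refl) , on-Ξ y (inj₂ refl)

  least greatest : Face
  least    = proj₁ (proj₁ i1)
  greatest = proj₁ (proj₂ i1)

  least-≼ : ∀ G → least ≼ G
  least-≼ = proj₂ (proj₁ i1)

  ≼-greatest : ∀ G → G ≼ greatest
  ≼-greatest = proj₂ (proj₂ i1)

  bottom : (Ψ : Fl) → face Ψ zero ≡ least
  bottom Ψ with maximal Ψ least (λ _ → inj₁ (least-≼ _))
  ... | k , least≡Ψk =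
    antisym (subst (face Ψ zero ≼_) (sym least≡Ψk) (face-mono Ψ ℕ.z≤n)) (least-≼ _)

  top : (Ψ : Fl) → face Ψ (fromℕ (suc n)) ≡ greatest
  top Ψ with maximal Ψ greatest (λ _ → inj₂ (≼-greatest _))
  ... | k , greatest≡Ψk =
    antisym (≼-greatest _) (subst (_≼ face Ψ (fromℕ (suc n))) (sym greatest≡Ψk)
                                  (face-mono Ψ (FP.≤fromℕ k)))

  ends-agree : (Ψ Ψ' : Fl) → Agree (Outside zero (fromℕ (suc n))) Ψ Ψ'
  ends-agree Ψ Ψ' i (inj₁ i≤0) with FP.≤-antisym i≤0 ℕ.z≤n
  ... | refl = trans (bottom Ψ) (sym (bottom Ψ'))
  ends-agree Ψ Ψ' i (inj₂ last≤i) with FP.≤-antisym (FP.≤fromℕ i) last≤i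
  ... | refl = trans (top Ψ) (sym (top Ψ'))

  aut-fixes-bottom : (φ : Aut _≼_) (Ψ : Fl) → to φ (face Ψ zero) ≡ face Ψ zero
  aut-fixes-bottom φ Ψ = begin
    to φ (face Ψ zero) ≡⟨ cong (to φ) (bottom Ψ) ⟩
    to φ least         ≡⟨ fixes-least ⟩
    least              ≡⟨ sym (bottom Ψ) ⟩
    face Ψ zero        ∎
    where
    open ≡-Reasoning
    fixes-least : to φ least ≡ least
    fixes-least = antisym (subst (to φ least ≼_) (to-from φ least) (to-mono φ (least-≼ (from φ least))))
                          (least-≼ _)

  image : Aut _≼_ → Fl → Fl
  image φ Ψ = record
    { face    = λ i → to φ (face Ψ i)
    ; strict  = λ i j i<j → to-mono φ (proj₁ (strict Ψ i j i<j))
                , λ e → proj₂ (strict Ψ i j i<j)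
                          (trans (sym (from-to φ _)) (trans (cong (from φ) e) (from-to φ _)))
    ; maximal = image-maximal
    }
    where
    pull-back : ∀ {G} x → Comparable _≼_ G (to φ x) → Comparable _≼_ (from φ G) x
    pull-back x (inj₁ G≼φx) = inj₁ (subst (from φ _ ≼_) (from-to φ x) (from-mono φ G≼φx))
    pull-back x (inj₂ φx≼G) = inj₂ (subst (_≼ from φ _) (from-to φ x) (from-mono φ φx≼G))
    image-maximal : ∀ G → (∀ i → Comparable _≼_ G (to φ (face Ψ i))) →
                    ∃ λ i → G ≡ to φ (face Ψ i)
    image-maximal G G~ with maximal Ψ (from φ G) (λ i → pull-back (face Ψ i) (G~ i))
    ... | k , φ⁻¹G≡Ψk = k , trans (sym (to-from φ G)) (cong (to φ) φ⁻¹G≡Ψk)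

  module Residue (J : Subset N) (j₀ : Fin N) (j₀∉J : j₀ ∉ J) where

    Step : Fl → Fl → Set a
    Step Ψ Ψ' = ∃ λ j → j ∉ J × Agree (_≢ j) Ψ Ψ'

    Connected : Fl → Fl → Set (a ⊔ ℓ)
    Connected = Star Step

    -- flags with the same faces are connected (formally by a step across j₀)
    same-faces : ∀ {Ψ Ψ'} → (∀ i → face Ψ i ≡ face Ψ' i) → Connected Ψ Ψ'
    same-faces Ψ≈Ψ' = (j₀ , j₀∉J , λ i _ → Ψ≈Ψ' i) ◅ ε

    -- the induction statement: flags agreeing on J and outside a window of
    -- width at most d are connected
    WindowConnected : ℕ → Set (a ⊔ ℓ)
    WindowConnected d = ∀ p q → toℕ q ℕ.≤ toℕ p ℕ.+ d → ∀ Ψ Ψ' →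
      Agree (Outside p q) Ψ Ψ' → Agree (_∈ J) Ψ Ψ' → Connected Ψ Ψ'

    narrow : ∀ {p q} → toℕ q ℕ.≤ suc (toℕ p) → ∀ {Ψ Ψ'} →
             Agree (Outside p q) Ψ Ψ' → Connected Ψ Ψ'
    narrow {p} {q} q≤1+p Ψ≈Ψ' = same-faces λ i → Ψ≈Ψ' i (everywhere i)
      where
      everywhere : ∀ i → Outside p q i
      everywhere i with position p q i
      ... | inj₁ o = o
      ... | inj₂ (p<i , i<q) = ⊥-elim (ℕP.<⇒≱ i<q (ℕP.≤-trans q≤1+p p<i))

    module Window {d : ℕ} (ih : WindowConnected d) (p q : Fin N)
                  (width : toℕ q ℕ.≤ toℕ p ℕ.+ suc d) where

      width′ : toℕ q ℕ.≤ suc (toℕ p ℕ.+ d)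
      width′ = subst (toℕ q ℕ.≤_) (ℕP.+-suc (toℕ p) d) width

      -- flags sharing the face at an interior position r are connected:
      -- splice them at r and connect across the two narrower windows
      split-at : ∀ {r} → p <ᶠ r → r <ᶠ q → ∀ {Ψ Ψ'} →
                 Agree (Outside p q) Ψ Ψ' → Agree (_∈ J) Ψ Ψ' →
                 face Ψ r ≡ face Ψ' r → Connected Ψ Ψ'
      split-at {r} p<r r<q {Ψ} {Ψ'} out onJ Ψr≡Ψ'r with splice Ψ Ψ' r Ψr≡Ψ'r
      ... | Ξ , low , high =
        ih r q (ℕP.≤-trans width′ (ℕP.+-monoˡ-≤ d p<r)) Ψ Ξ lower-out (proj₁ onJ′)
        ◅◅ ih p r (ℕP.≤-pred (ℕP.≤-trans r<q width′)) Ξ Ψ' upper-out (proj₂ onJ′)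
        where
        onJ′ : Agree (_∈ J) Ψ Ξ × Agree (_∈ J) Ξ Ψ'
        onJ′ = spliced-agrees {Ψ} {Ψ'} {Ξ} {r} low high onJ
        out′ : Agree (Outside p q) Ψ Ξ × Agree (Outside p q) Ξ Ψ'
        out′ = spliced-agrees {Ψ} {Ψ'} {Ξ} {r} low high out
        lower-out : Agree (Outside r q) Ψ Ξ
        lower-out i (inj₁ i≤r) = low i i≤r
        lower-out i (inj₂ q≤i) = proj₁ out′ i (inj₂ q≤i)
        upper-out : Agree (Outside p r) Ξ Ψ'
        upper-out i (inj₁ i≤p) = proj₂ out′ i (inj₁ i≤p)
        upper-out i (inj₂ r≤i) = high i r≤i

      above : suc (toℕ p) ℕ.< toℕ q → Fin N
      above gap = fromℕ< (ℕP.<-trans gap (FP.toℕ<n q))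

      toℕ-above : (gap : suc (toℕ p) ℕ.< toℕ q) → toℕ (above gap) ≡ suc (toℕ p)
      toℕ-above gap = FP.toℕ-fromℕ< (ℕP.<-trans gap (FP.toℕ<n q))

      p<above : (gap : suc (toℕ p) ℕ.< toℕ q) → p <ᶠ above gap
      p<above gap = subst (toℕ p ℕ.<_) (sym (toℕ-above gap)) (ℕP.n<1+n _)

      above<q : (gap : suc (toℕ p) ℕ.< toℕ q) → above gap <ᶠ q
      above<q gap = subst (ℕ._< toℕ q) (sym (toℕ-above gap)) gap

      across-one : (gap : suc (toℕ p) ℕ.< toℕ q) → toℕ q ≡ 2 ℕ.+ toℕ p → above gap ∉ J →
                   ∀ {Ψ Ψ'} → Agree (Outside p q) Ψ Ψ' → Connected Ψ Ψ'
      across-one gap q≡2+p above∉J out =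
        (above gap , above∉J , λ i i≢above → out i (outside-except i i≢above)) ◅ ε
        where
        outside-except : ∀ i → i ≢ above gap → Outside p q i
        outside-except i i≢above with position p q i
        ... | inj₁ o = o
        ... | inj₂ (p<i , i<q) = ⊥-elim (i≢above (FP.toℕ-injective
              (trans (ℕP.≤-antisym (ℕP.≤-pred (subst (suc (toℕ i) ℕ.≤_) q≡2+p i<q)) p<i)
                     (sym (toℕ-above gap)))))

      J-outside-window : ¬ (∃ λ j → j ∈ J × p <ᶠ j × j <ᶠ q) → ∀ i → i ∈ J → Outside p q i
      J-outside-window none i i∈J with position p q i
      ... | inj₁ o = o
      ... | inj₂ (p<i , i<q) = ⊥-elim (none (i , i∈J , p<i , i<q))

      module Free (outside-J : ∀ i → i ∈ J → Outside p q i) where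

        through-common-face : ∀ Ψ {Ξ Θ} z → Agree (Outside p q) Ψ Ξ → Agree (Outside p q) Ψ Θ →
          face Ψ p ≺ z → z ≺ face Ψ q → OnFlag Ξ z → OnFlag Θ z → Connected Ξ Θ
        through-common-face Ψ {Ξ} {Θ} z Ψ≈Ξ Ψ≈Θ pz zq (r , z≡Ξr) (k , z≡Θk) =
          split-at p<r r<q Ξ≈Θ (λ i i∈J → Ξ≈Θ i (outside-J i i∈J))
                   (on-flag-at Θ Ξ r (k , trans (sym z≡Ξr) z≡Θk))
          where
          Ξ≈Θ : Agree (Outside p q) Ξ Θ
          Ξ≈Θ i o = trans (sym (Ψ≈Ξ i o)) (Ψ≈Θ i o)
          p<r : p <ᶠ r
          p<r = face-reflect Ξ p r (subst₂ _≺_ (Ψ≈Ξ p (inj₁ FP.≤-refl)) z≡Ξr pz)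
          r<q : r <ᶠ q
          r<q = face-reflect Ξ r q (subst₂ _≺_ z≡Ξr (Ψ≈Ξ q (inj₂ FP.≤-refl)) zq)

        -- a window spanning a section of rank ≥ 2: walk along a path in the
        -- section (I3) from the p₁-th face of Ψ to that of Ψ'
        across-section : 3 ℕ.+ toℕ p ℕ.≤ toℕ q → ∀ {Ψ Ψ'} →
                         Agree (Outside p q) Ψ Ψ' → Connected Ψ Ψ'
        across-section gap₃ {Ψ} {Ψ'} out =
          fold (λ x y → Reach x → Reach y) (λ l k → k ∘ reach-link l) id path
               reach-start Ψ' out (p₁ , refl)
          where
          gap : suc (toℕ p) ℕ.< toℕ q
          gap = ℕP.≤-trans (ℕP.n≤1+n _) gap₃
          p₁ : Fin N
          p₁ = above gap
          Reach : Face → Set (a ⊔ ℓ)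
          Reach x = ∀ Θ → Agree (Outside p q) Ψ Θ → OnFlag Θ x → Connected Ψ Θ
          reach-start : Reach (face Ψ p₁)
          reach-start Θ Ψ≈Θ =
            through-common-face Ψ (face Ψ p₁) (λ _ _ → refl) Ψ≈Θ
              (strict Ψ p p₁ (p<above gap)) (strict Ψ p₁ q (above<q gap)) (p₁ , refl)
          reach-link : ∀ {x y} → Link _≼_ (face Ψ p) (face Ψ q) x y → Reach x → Reach y
          reach-link ((px , xq) , (py , yq) , x~y) reach-x Θ Ψ≈Θ y∈Θ
            with extend-in-section Ψ p q (proj₁ px) (proj₁ xq) (proj₁ py) (proj₁ yq) x~y
          ... | Ξ , Ψ≈Ξ , x∈Ξ , y∈Ξ =
            reach-x Ξ Ψ≈Ξ x∈Ξ ◅◅ through-common-face Ψ _ Ψ≈Ξ Ψ≈Θ py yq y∈Ξ y∈Θ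
          path : Star (Link _≼_ (face Ψ p) (face Ψ q)) (face Ψ p₁) (face Ψ' p₁)
          path = i3 (face Ψ p) (face Ψ q) p q (Ψ , refl) (Ψ , refl) gap₃
                    (face Ψ p₁) (face Ψ' p₁)
                    (strict Ψ p p₁ (p<above gap)) (strict Ψ p₁ q (above<q gap))
                    (subst (_≺ face Ψ' p₁) (sym (out p (inj₁ FP.≤-refl)))
                           (strict Ψ' p p₁ (p<above gap)))
                    (subst (face Ψ' p₁ ≺_) (sym (out q (inj₂ FP.≤-refl)))
                           (strict Ψ' p₁ q (above<q gap)))

      -- the four cases: no interior position; an interior position in J; a single
      -- interior position, not in J; at least two interior positions, none in J
      connect : ∀ Ψ Ψ' → Agree (Outside p q) Ψ Ψ' → Agree (_∈ J) Ψ Ψ' → Connected Ψ Ψ'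
      connect Ψ Ψ' out onJ with toℕ q ℕ.≤? suc (toℕ p)
      ... | yes q≤1+p = narrow q≤1+p out
      ... | no q≰1+p with FP.any? (λ j → (j ∈? J) ×-dec ((p FP.<? j) ×-dec (j FP.<? q)))
      ... | yes (j , j∈J , p<j , j<q) = split-at p<j j<q out onJ (onJ j j∈J)
      ... | no no-J-inside with toℕ q ℕ.≟ 2 ℕ.+ toℕ p
      ... | yes q≡2+p = across-one gap q≡2+p
                          (λ above∈J → no-J-inside (above gap , above∈J , p<above gap , above<q gap)) out
        where
        gap : suc (toℕ p) ℕ.< toℕ q
        gap = ℕP.≰⇒> q≰1+p
      ... | no q≢2+p = Free.across-section (J-outside-window no-J-inside)
                         (ℕP.≤∧≢⇒< (ℕP.≰⇒> q≰1+p) (q≢2+p ∘ sym)) out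

    window-connected : ∀ d → WindowConnected d
    window-connected ℕ.zero p q q≤p+0 _ _ out _ =
      narrow (ℕP.≤-trans q≤p+0 (ℕP.≤-trans (ℕP.≤-reflexive (ℕP.+-identityʳ _)) (ℕP.n≤1+n _))) out
    window-connected (suc d) p q width =
      Window.connect (window-connected d) p q width

    connected : ∀ Ψ Ψ' → Agree (_∈ J) Ψ Ψ' → Connected Ψ Ψ'
    connected Ψ Ψ' = window-connected (suc n) zero (fromℕ (suc n))
                       (ℕP.≤-reflexive (FP.toℕ-fromℕ (suc n))) Ψ Ψ' (ends-agree Ψ Ψ')

module FlagStabilizers {a ℓ b : Level} {Face : Set a} (_≼_ : Face → Face → Set ℓ) (n : ℕ)
       (ic : IsIncidenceComplex _≼_ n) (Γ : Aut _≼_ → Set b)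
       (Γ-subgroup : IsSubgroup _≼_ Γ) (Γ-flag-transitive : FlagTransitive _≼_ n Γ)
       (Φ : Flag _≼_ n) where
  open FlagTheory _≼_ n ic
  open IsSubgroup Γ-subgroup renaming (resp to Γ-resp)

  _·_ : Aut _≼_ → Aut _≼_ → Aut _≼_
  _·_ = _∙_ _≼_

  inverse : Aut _≼_ → Aut _≼_
  inverse = _⁻¹ _≼_

  generated⊆stabilizer : (J : Subset N) → ∀ φ → ⟨_⟩ _≼_ (Gens _≼_ Γ Φ J) φ → Stab _≼_ Γ Φ J φ
  generated⊆stabilizer J φ (gen (j , j∉J , Γφ , φ-fix)) =
    Γφ , λ i i∈J → φ-fix i (λ i≡j → j∉J (subst (_∈ J) i≡j i∈J))
  generated⊆stabilizer J _ unit = has-id , λ _ _ → refl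
  generated⊆stabilizer J _ (mul {φ} {ψ} gφ gψ)
    with generated⊆stabilizer J φ gφ | generated⊆stabilizer J ψ gψ
  ... | Γφ , φ-fix | Γψ , ψ-fix =
    has-∙ Γφ Γψ , λ i i∈J → trans (cong (to ψ) (φ-fix i i∈J)) (ψ-fix i i∈J)
  generated⊆stabilizer J _ (inv {φ} gφ) with generated⊆stabilizer J φ gφ
  ... | Γφ , φ-fix =
    has-⁻¹ Γφ , λ i i∈J → trans (cong (from φ) (sym (φ-fix i i∈J))) (from-to φ _)
  generated⊆stabilizer J ψ (resp {φ} φ≈ψ gφ) with generated⊆stabilizer J φ gφ
  ... | Γφ , φ-fix = Γ-resp φ≈ψ Γφ , λ i i∈J → trans (sym (φ≈ψ _)) (φ-fix i i∈J)

  module _ (J : Subset N) (j₀ : Fin N) (j₀∉J : j₀ ∉ J) where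
    open Residue J j₀ j₀∉J

    Reachable : Fl → Set (a ⊔ ℓ ⊔ b)
    Reachable Ψ = Σ (Aut _≼_) λ γ →
      ⟨_⟩ _≼_ (Gens _≼_ Γ Φ J) γ × (∀ i → to γ (face Φ i) ≡ face Ψ i)

    -- if Φγ = Ψ and Ψ' is adjacent to Ψ across j, then Φρ = Ψ'γ⁻¹ for some
    -- ρ ∈ Γ by flag transitivity; ρ fixes every F_i, i ≠ j, so ρ ∈ R_j, and
    -- Φ(ργ) = Ψ'
    reach-step : ∀ {Ψ Ψ'} → Step Ψ Ψ' → Reachable Ψ → Reachable Ψ'
    reach-step {Ψ} {Ψ'} (j , j∉J , Ψ≈Ψ') (γ , γ-gen , Φγ≡Ψ)
      with Γ-flag-transitive Φ (image (inverse γ) Ψ')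
    ... | ρ , Γρ , Φρ≡Ψ'γ⁻¹ =
      (ρ · γ) , mul (gen (j , j∉J , Γρ , ρ∈R)) γ-gen ,
      λ i → trans (cong (to γ) (Φρ≡Ψ'γ⁻¹ i)) (to-from γ _)
      where
      open ≡-Reasoning
      ρ∈R : ∀ i → i ≢ j → to ρ (face Φ i) ≡ face Φ i
      ρ∈R i i≢j = begin
        to ρ (face Φ i)          ≡⟨ Φρ≡Ψ'γ⁻¹ i ⟩
        from γ (face Ψ' i)       ≡⟨ cong (from γ) (sym (Ψ≈Ψ' i i≢j)) ⟩
        from γ (face Ψ i)        ≡⟨ cong (from γ) (sym (Φγ≡Ψ i)) ⟩
        from γ (to γ (face Φ i)) ≡⟨ from-to γ _ ⟩
        face Φ i                 ∎

    reach : ∀ {Ψ Ψ'} → Connected Ψ Ψ' → Reachable Ψ → Reachable Ψ'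
    reach = fold (λ Ψ Ψ' → Reachable Ψ → Reachable Ψ') (λ {Ψ} {Ψ'} s k → k ∘ reach-step {Ψ} {Ψ'} s) id

    -- for φ ∈ Stab(Φ_J) the flag Φφ agrees with Φ on J, so Φφ = Φγ for some
    -- γ ∈ ⟨R_j : j ∉ J⟩; then φγ⁻¹ fixes Φ, hence lies in R_{j₀}, and
    -- φ = (φγ⁻¹)γ
    stabilizer⊆generated : ∀ φ → Stab _≼_ Γ Φ J φ → ⟨_⟩ _≼_ (Gens _≼_ Γ Φ J) φ
    stabilizer⊆generated φ (Γφ , φ-fix)
      with reach (connected Φ (image φ Φ) (λ i i∈J → sym (φ-fix i i∈J)))
                 (idA _≼_ , unit , λ _ → refl)
    ... | γ , γ-gen , Φγ≡Φφ =
      resp (λ x → to-from γ (to φ x)) (mul (gen (j₀ , j₀∉J , Γψ , λ i _ → ψ-fixes i)) γ-gen)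
      where
      ψ : Aut _≼_
      ψ = φ · inverse γ
      Γψ : Γ ψ
      Γψ = has-∙ Γφ (has-⁻¹ (proj₁ (generated⊆stabilizer J γ γ-gen)))
      ψ-fixes : ∀ i → to ψ (face Φ i) ≡ face Φ i
      ψ-fixes i = trans (cong (from γ) (sym (Φγ≡Φφ i))) (from-to γ _)

  -- Stab(Φ) = R_{-1}: the only extra condition in R_{-1}, fixing F_{-1}, holds
  -- for every automorphism.
  full-stabilizer : Stab _≼_ Γ Φ ⊤ ≐ R _≼_ Γ Φ zero
  full-stabilizer =
      (λ φ (Γφ , φ-fix) → Γφ , λ j _ → φ-fix j ∈⊤)
    , (λ φ (Γφ , φ-fix) → Γφ , λ { zero _ → aut-fixes-bottom φ Φ
                                 ; (fsuc k) _ → φ-fix (fsuc k) (λ ()) })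

lemma3p1 : ∀ {a ℓ b : Level} {Face : Set a} (_≼_ : Face → Face → Set ℓ) (n : ℕ) →
    1 ≤ n → IsIncidenceComplex _≼_ n → Regular _≼_ n →
    (Γ : Aut _≼_ → Set b) → IsSubgroup _≼_ Γ → FlagTransitive _≼_ n Γ →
    (Φ : Flag _≼_ n) → (J : Subset (suc (suc n))) →
    (J ≢ ⊤ → Stab _≼_ Γ Φ J ≐ ⟨_⟩ _≼_ (Gens _≼_ Γ Φ J)) ×
    (J ≡ ⊤ → Stab _≼_ Γ Φ J ≐ R _≼_ Γ Φ zero)
lemma3p1 _≼_ n _ ic _ Γ Γ-subgroup Γ-flag-transitive Φ J =
  (λ J≢⊤ → proper (missing-position J J≢⊤)) , (λ { refl → full-stabilizer })
  where
  open FlagStabilizers _≼_ n ic Γ Γ-subgroup Γ-flag-transitive Φ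
  proper : ∃ (_∉ J) → Stab _≼_ Γ Φ J ≐ ⟨_⟩ _≼_ (Gens _≼_ Γ Φ J)
  proper (j₀ , j₀∉J) = stabilizer⊆generated J j₀ j₀∉J , generated⊆stabilizer J
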